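{- Let $H=(V,\mathcal{E})$ be an acyclic hypergraph with $m$ hyperedges and $T$ a join tree for $H$. Root $T$ at an arbitrary hyperedge $R$ and let $\langle R=E_1,E_2,\dots,E_m\rangle$ be a pre-order of $T$. For each vertex $v$ let $\lambda(v)=\min\{i : v\in E_i\}$. Now for $i=2,3,\dots,m$ in this order, set $S^{\uparrow}(E_i)=\{v\in E_i : \lambda(v)<i\}$, let $j=\max\{\lambda(v): v\in S^{\uparrow}(E_i)\}$, and make $E_j$ the parent of $E_i$ (replacing the current parent of $E_i$). The resulting tree $T'$ is a valid join tree for $H$.
   Context: Hypergraphs have nonempty hyperedges, distinct hyperedges may be equal as sets, and the incidence graph is connected. A join tree for $H$ is a tree whose nodes are the hyperedges such that, for every vertex $v$, the hyperedges containing $v$ induce a connected subtree; $H$ is acyclic if it has a join tree. -}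

module Defs where

open import Data.Nat as ℕ using (ℕ; zero; suc)
open import Data.Fin using (Fin; zero; suc; toℕ; _≤_; _<_)
open import Data.Fin.Subset using (Subset; _∈_; Nonempty)
open import Data.Fin.Subset.Properties using (_∈?_)
open import Data.Bool using (Bool; true; false; if_then_else_; _∧_)
open import Data.Maybe using (Maybe; just; nothing; maybe)
open import Data.Maybe as Maybe using ()
open import Data.List using (List; foldr; allFin)
open import Data.Product using (Σ; ∃; _×_; _,_)
open import Data.Sum using (_⊎_; inj₁; inj₂)
open import Relation.Nullary using (¬_; does)
open import Relation.Binary.PropositionalEquality using (_≡_; _≢_)
open import Relation.Binary.Construct.Closure.ReflexiveTransitive using (Star)
open import Function.Bundles using (_↔_; Inverse)

-- Hypergraphs: vertex set Fin n, hyperedges indexed by Fin m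
-- (so distinct hyperedges may be equal as sets).

Hypergraph : ℕ → ℕ → Set
Hypergraph n m = Fin m → Subset n

NonemptyEdges : ∀ {n m} → Hypergraph n m → Set
NonemptyEdges E = ∀ e → Nonempty (E e)

IncAdj : ∀ {n m} → Hypergraph n m → Fin n ⊎ Fin m → Fin n ⊎ Fin m → Set
IncAdj E (inj₁ v) (inj₂ e) = v ∈ E e
IncAdj E (inj₂ e) (inj₁ v) = v ∈ E e
IncAdj E _        _        = Data.Empty.⊥
  where import Data.Empty

IncidenceConnected : ∀ {n m} → Hypergraph n m → Set
IncidenceConnected E = ∀ a b → Star (IncAdj E) a b

iter : ∀ {A : Set} → (A → A) → ℕ → A → A
iter f zero    x = x
iter f (suc k) x = f (iter f k x)

IsRootedTree : ∀ {m} → (Fin m → Fin m) → Fin m → Set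
IsRootedTree par r = (par r ≡ r) × (∀ x → ∃ λ k → iter par k x ≡ r)

TreeAdj : ∀ {m} → (Fin m → Fin m) → Fin m → Fin m → Set
TreeAdj par x y = (x ≢ y) × ((par x ≡ y) ⊎ (par y ≡ x))

SubtreeConnected : ∀ {n m} → Hypergraph n m → (Fin m → Fin m) → Fin n → Set
SubtreeConnected E par v =
  ∀ x y → v ∈ E x → v ∈ E y →
    Star (λ a b → (v ∈ E a) × (v ∈ E b) × TreeAdj par a b) x y

IsJoinTree : ∀ {n m} → Hypergraph n m → (Fin m → Fin m) → Fin m → Set
IsJoinTree E par r = IsRootedTree par r × (∀ v → SubtreeConnected E par v)

Desc : ∀ {m} → (Fin m → Fin m) → Fin m → Fin m → Set
Desc par y x = ∃ λ k → iter par k y ≡ x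

-- ord : position ↦ node is a pre-order of the rooted tree par:
-- the subtree of every node x occupies a contiguous block of positions
-- starting at the position of x.
IsPreorder : ∀ {m} → (Fin m → Fin m) → Fin m ↔ Fin m → Set
IsPreorder {m} par ord =
  (∀ x y → Desc par y x → pos x ≤ pos y) ×
  (∀ x y (k : Fin m) → Desc par y x → pos x ≤ k → k ≤ pos y →
     Desc par (Inverse.to ord k) x)
  where pos = Inverse.from ord

minIndex : ∀ {m} → (Fin m → Bool) → Maybe (Fin m)
minIndex {zero}  f = nothing
minIndex {suc m} f = if f zero then just zero else Maybe.map suc (minIndex (λ i → f (suc i)))

maxFin : ∀ {m} → Fin m → Fin m → Fin m
maxFin i j = if does (Data.Fin._≤?_ i j) then j else i
  where import Data.Fin

-- λ(v) = min { i : v ∈ E_i }, positions i taken in the pre-order ord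
lam : ∀ {n m} → Hypergraph n m → Fin m ↔ Fin m → Fin n → Maybe (Fin m)
lam E ord v = minIndex (λ i → does (v ∈? E (Inverse.to ord i)))

-- is v ∈ S↑(E_i), i.e. v ∈ E_i and λ(v) < i ?  (returns λ(v) if so)
upλ : ∀ {n m} → Hypergraph n m → Fin m ↔ Fin m → Fin m → Fin n → Maybe (Fin m)
upλ E ord i v with does (v ∈? E (Inverse.to ord i)) | lam E ord v
... | true | just l = if does (Data.Fin._<?_ l i) then just l else nothing
  where import Data.Fin
... | _    | _      = nothing

maxMaybe : ∀ {m} → Maybe (Fin m) → Maybe (Fin m) → Maybe (Fin m)
maxMaybe (just a) (just b) = just (maxFin a b)
maxMaybe (just a) nothing  = just a
maxMaybe nothing  b        = b

-- j = max { λ(v) : v ∈ S↑(E_i) }  (nothing if S↑(E_i) is empty)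
parentIndex : ∀ {n m} → Hypergraph n m → Fin m ↔ Fin m → Fin m → Maybe (Fin m)
parentIndex {n} E ord i = foldr (λ v acc → maxMaybe (upλ E ord i v) acc) nothing (allFin n)

-- the new parent function T': the node at position i gets parent E_j;
-- a node with S↑ empty (in particular the root, position 0) is its own parent.
newParent : ∀ {n m} → Hypergraph n m → Fin m ↔ Fin m → Fin m → Fin m
newParent E ord x = maybe (Inverse.to ord) x (parentIndex E ord (Inverse.from ord x))

{-# OPTIONS --safe #-}
-- For a vertex v, the hyperedges containing v form a subtree of T, and since ancestors come
-- first in the order its top is E_λ(v).  If v ∈ E_i and E_i is not that top, then
-- v ∈ S↑(E_i), so the new parent E_j of E_i has λ(v) ≤ j < i.  As E_j and E_λ(v) are both
-- ancestors of E_i in T, either E_j lies on the T-path from E_i to E_λ(v) or j = λ(v); in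
-- both cases v ∈ E_j.  So new parents lead from E_i to E_λ(v) inside the hyperedges
-- containing v, which gives the connectivity condition for T′.  If S↑(E_i) is empty, the
-- T-subtree below E_i is closed under incidence, so by connectivity of the incidence graph
-- it contains R and E_i = R; hence new parents decrease positions until they reach R.
module Submission where

open import Defs
open import Data.Nat using (ℕ)
open import Data.Fin using (Fin)
open import Function.Bundles using (_↔_)

open import Data.Bool using (if_then_else_)
open import Data.Empty using (⊥-elim)
open import Data.Fin as Fin using (_≤_; _<_; _≟_; _≤?_; _<?_; toℕ)
import Data.Fin.Properties as Fin
open import Data.Fin.Subset using (_∈_)
open import Data.Fin.Subset.Properties using (_∈?_)
open import Data.List using (List; _∷_; foldr; allFin)
open import Data.List.Membership.Propositional using () renaming (_∈_ to _∈ₗ_)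
open import Data.List.Membership.Propositional.Properties using (∈-allFin)
open import Data.List.Relation.Unary.Any using (here; there)
open import Data.Maybe using (Maybe; just; nothing)
open import Data.Nat as ℕ using (zero; suc; _+_; z≤n; s≤s)
open import Data.Nat.Induction using (<-wellFounded)
import Data.Nat.Properties as ℕ
open import Data.Product using (∃; _×_; _,_; proj₁; proj₂)
open import Data.Sum using (_⊎_; inj₁; inj₂)
open import Data.Unit using (⊤)
open import Function using (_∘_; id)
open import Function.Bundles using (Inverse; Injection)
open import Function.Properties.Inverse using (↔-sym; ↔⇒↣)
open import Induction.WellFounded using (Acc; acc)
open import Relation.Binary.Construct.Closure.ReflexiveTransitive as Star
  using (Star; ε; _◅_; _◅◅_)
open import Relation.Binary.PropositionalEquality
open import Relation.Nullary using (¬_; does; yes; no)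
open import Relation.Nullary.Decidable using (dec-true; dec-false)
open import Relation.Unary using (Decidable)

iter-suc : ∀ {A : Set} (f : A → A) k x → iter f (suc k) x ≡ iter f k (f x)
iter-suc f zero    x = refl
iter-suc f (suc k) x = cong f (iter-suc f k x)

iter-+ : ∀ {A : Set} (f : A → A) j k x → iter f (j + k) x ≡ iter f j (iter f k x)
iter-+ f zero    k x = refl
iter-+ f (suc j) k x = cong f (iter-+ f j k x)

minIndex-sound : ∀ {m} {P : Fin m → Set} (P? : Decidable P) {l} →
                 minIndex (λ i → does (P? i)) ≡ just l → P l
minIndex-sound {suc m} P? eq with P? Fin.zero
... | yes p with refl ← eq = p
... | no _ with minIndex (λ i → does (P? (Fin.suc i))) in q
...   | just l  with refl ← eq = minIndex-sound (λ i → P? (Fin.suc i)) q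
...   | nothing with () ← eq

minIndex-least : ∀ {m} {P : Fin m → Set} (P? : Decidable P) {l} →
                 minIndex (λ i → does (P? i)) ≡ just l → ∀ {i} → P i → l ≤ i
minIndex-least {suc m} P? eq {i} pi with P? Fin.zero
... | yes _ with refl ← eq = z≤n
... | no ¬p0 with minIndex (λ i → does (P? (Fin.suc i))) in q | i
...   | just l  | Fin.zero  = ⊥-elim (¬p0 pi)
...   | just l  | Fin.suc i with refl ← eq = s≤s (minIndex-least (λ i → P? (Fin.suc i)) q pi)
...   | nothing | _ with () ← eq

minIndex-complete : ∀ {m} {P : Fin m → Set} (P? : Decidable P) {i} →
                    P i → ∃ λ l → minIndex (λ i → does (P? i)) ≡ just l
minIndex-complete {suc m} P? {i} pi with P? Fin.zero
... | yes _ = Fin.zero , refl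
... | no ¬p0 with minIndex (λ i → does (P? (Fin.suc i))) in q | i
...   | just l  | _         = Fin.suc l , refl
...   | nothing | Fin.zero  = ⊥-elim (¬p0 pi)
...   | nothing | Fin.suc i
  with _ , q′ ← minIndex-complete (λ i → P? (Fin.suc i)) pi
  with () ← trans (sym q) q′

maxFin-≤ : ∀ {m} {i j : Fin m} → i ≤ j → maxFin i j ≡ j
maxFin-≤ {i = i} {j} i≤j = cong (if_then j else i) (dec-true (i ≤? j) i≤j)

maxFin-≰ : ∀ {m} {i j : Fin m} → ¬ i ≤ j → maxFin i j ≡ i
maxFin-≰ {i = i} {j} i≰j = cong (if_then j else i) (dec-false (i ≤? j) i≰j)

maxFin-selective : ∀ {m} (i j : Fin m) → maxFin i j ≡ i ⊎ maxFin i j ≡ j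
maxFin-selective i j with i ≤? j
... | yes i≤j = inj₂ (maxFin-≤ i≤j)
... | no  i≰j = inj₁ (maxFin-≰ i≰j)

maxFin-upperˡ : ∀ {m} (i j : Fin m) → i ≤ maxFin i j
maxFin-upperˡ i j with i ≤? j
... | yes i≤j rewrite maxFin-≤ i≤j = i≤j
... | no  i≰j rewrite maxFin-≰ i≰j = Fin.≤-refl

maxFin-upperʳ : ∀ {m} (i j : Fin m) → j ≤ maxFin i j
maxFin-upperʳ i j with i ≤? j
... | yes i≤j rewrite maxFin-≤ i≤j = Fin.≤-refl
... | no  i≰j rewrite maxFin-≰ i≰j = ℕ.<⇒≤ (ℕ.≰⇒> i≰j)

maxMaybe-selective : ∀ {m} (a b : Maybe (Fin m)) {j} →
                     maxMaybe a b ≡ just j → a ≡ just j ⊎ b ≡ just j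
maxMaybe-selective (just a) (just b) eq with maxFin-selective a b
... | inj₁ max≡a = inj₁ (trans (cong just (sym max≡a)) eq)
... | inj₂ max≡b = inj₂ (trans (cong just (sym max≡b)) eq)
maxMaybe-selective (just a) nothing  eq = inj₁ eq
maxMaybe-selective nothing  b        eq = inj₂ eq

maxMaybe-upperˡ : ∀ {m} (l : Fin m) b → ∃ λ j → maxMaybe (just l) b ≡ just j × l ≤ j
maxMaybe-upperˡ l (just b) = maxFin l b , refl , maxFin-upperˡ l b
maxMaybe-upperˡ l nothing  = l , refl , Fin.≤-refl

maxMaybe-upperʳ : ∀ {m} a (l : Fin m) → ∃ λ j → maxMaybe a (just l) ≡ just j × l ≤ j
maxMaybe-upperʳ (just a) l = maxFin a l , refl , maxFin-upperʳ a l
maxMaybe-upperʳ nothing  l = l , refl , Fin.≤-refl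

module _ {A : Set} {m} (g : A → Maybe (Fin m)) where

  maxOf : List A → Maybe (Fin m)
  maxOf = foldr (λ a acc → maxMaybe (g a) acc) nothing

  maxOf-attained : ∀ xs {j} → maxOf xs ≡ just j → ∃ λ a → g a ≡ just j
  maxOf-attained (a ∷ as) eq with maxMaybe-selective (g a) (maxOf as) eq
  ... | inj₁ ga≡j   = a , ga≡j
  ... | inj₂ rest≡j = maxOf-attained as rest≡j

  maxOf-upper : ∀ {xs a l} → a ∈ₗ xs → g a ≡ just l →
                ∃ λ j → maxOf xs ≡ just j × l ≤ j
  maxOf-upper {_ ∷ as} {l = l} (here refl) ga≡l rewrite ga≡l = maxMaybe-upperˡ l (maxOf as)
  maxOf-upper {b ∷ _} (there a∈xs) ga≡l with maxOf-upper a∈xs ga≡l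
  ... | j , rest≡j , l≤j rewrite rest≡j with maxMaybe-upperʳ (g b) j
  ...   | k , max≡k , j≤k = k , max≡k , Fin.≤-trans l≤j j≤k

module _ {m} (par : Fin m → Fin m) where

  desc-trans : ∀ {x y z} → Desc par x y → Desc par y z → Desc par x z
  desc-trans {x} {y} {z} (j , x↑j≡y) (k , y↑k≡z) = k + j , (begin
    iter par (k + j) x        ≡⟨ iter-+ par k j x ⟩
    iter par k (iter par j x) ≡⟨ cong (iter par k) x↑j≡y ⟩
    iter par k y              ≡⟨ y↑k≡z ⟩
    z                         ∎)
    where open ≡-Reasoning

  desc-parent : ∀ {x y} → Desc par x y → x ≡ y ⊎ Desc par (par x) y
  desc-parent (zero  , x≡y) = inj₁ x≡y
  desc-parent {x} (suc k , eq) = inj₂ (k , trans (sym (iter-suc par k x)) eq)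

  ancestors-comparable : ∀ {x a b} → Desc par x a → Desc par x b →
                         Desc par a b ⊎ Desc par b a
  ancestors-comparable {a = a} {b} (j , eq₁) (k , eq₂) = comparable j k eq₁ eq₂
    where
    comparable : ∀ {x} j k → iter par j x ≡ a → iter par k x ≡ b →
                 Desc par a b ⊎ Desc par b a
    comparable zero    k       refl eq₂  = inj₁ (k , eq₂)
    comparable (suc j) zero    eq₁  refl = inj₂ (suc j , eq₁)
    comparable {x} (suc j) (suc k) eq₁ eq₂ =
      comparable j k (trans (sym (iter-suc par j x)) eq₁) (trans (sym (iter-suc par k x)) eq₂)

InducedAdj : ∀ {m} → (Fin m → Fin m) → (Fin m → Set) → Fin m → Fin m → Set
InducedAdj par P a b = P a × P b × TreeAdj par a b

UpStep : ∀ {m} → (Fin m → Fin m) → (Fin m → Set) → Fin m → Fin m → Set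
UpStep f Q a b = Q a × Q b × a ≢ b × f a ≡ b

upStep⇒adj : ∀ {m} {f : Fin m → Fin m} {Q a b} → UpStep f Q a b → InducedAdj f Q a b
upStep⇒adj (qa , qb , a≢b , fa≡b) = qa , qb , a≢b , inj₁ fa≡b

upStep⇒adj⁻¹ : ∀ {m} {f : Fin m → Fin m} {Q a b} → UpStep f Q a b → InducedAdj f Q b a
upStep⇒adj⁻¹ (qa , qb , a≢b , fa≡b) = qb , qa , a≢b ∘ sym , inj₂ fa≡b

upPath⇒desc : ∀ {m} {f : Fin m → Fin m} {Q x y} → Star (UpStep f Q) x y → Desc f x y
upPath⇒desc ε                          = 0 , refl
upPath⇒desc {f = f} ((_ , _ , _ , refl) ◅ path) = desc-trans f (1 , refl) (upPath⇒desc path)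

climb : ∀ {m} (f : Fin m → Fin m) (Q : Fin m → Set) (μ : Fin m → ℕ) (t : Fin m) →
        (∀ {x} → Q x → x ≢ t → Q (f x) × μ (f x) ℕ.< μ x) →
        ∀ {x} → Q x → Star (UpStep f Q) x t
climb f Q μ t step {x} qx = go qx (<-wellFounded (μ x))
  where
  go : ∀ {x} → Q x → Acc ℕ._<_ (μ x) → Star (UpStep f Q) x t
  go {x} qx (acc smaller) with x ≟ t
  ... | yes refl = ε
  ... | no  x≢t with step qx x≢t
  ...   | qfx , μfx<μx = (qx , qfx , x≢fx , refl) ◅ go qfx (smaller μfx<μx)
    where
    x≢fx : x ≢ f x
    x≢fx x≡fx = ℕ.<-irrefl (cong μ (sym x≡fx)) μfx<μx

module AncestralOrder {m} (par : Fin m → Fin m) (pos : Fin m → Fin m)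
  (pos-injective : ∀ {x y} → pos x ≡ pos y → x ≡ y)
  (pos-ancestral : ∀ {x y} → Desc par y x → pos x ≤ pos y) where

  desc-antisym : ∀ {x y} → Desc par x y → Desc par y x → x ≡ y
  desc-antisym x≤y y≤x =
    pos-injective (Fin.≤-antisym (pos-ancestral y≤x) (pos-ancestral x≤y))

  module ConnectedSubtree (P : Fin m → Set) (P? : Decidable P)
    (connected : ∀ x y → P x → P y → Star (InducedAdj par P) x y) where

    stays-below : ∀ {y b c} → (P (par y) → par y ≡ y) →
                  Desc par b y → Star (InducedAdj par P) b c → Desc par c y
    stays-below closed b≤y ε = b≤y
    stays-below closed b≤y ((_ , _ , _ , inj₂ par-c≡b) ◅ path) =
      stays-below closed (desc-trans par (1 , par-c≡b) b≤y) path
    stays-below closed b≤y ((_ , pc , b≢c , inj₁ par-b≡c) ◅ path)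
      with desc-parent par b≤y
    ... | inj₂ par-b≤y =
      stays-below closed (subst (λ z → Desc par z _) par-b≡c par-b≤y) path
    ... | inj₁ refl    =
      ⊥-elim (b≢c (sym (trans (sym par-b≡c) (closed (subst P (sym par-b≡c) pc)))))

    least-is-top : ∀ {t} → P t → (∀ {x} → P x → pos t ≤ pos x) →
                   ∀ {y} → P y → Desc par y t
    least-is-top {t} pt least {y} py = stays-below par-t≡t (0 , refl) (connected t y pt py)
      where
      par-t≡t : P (par t) → par t ≡ t
      par-t≡t p = pos-injective (Fin.≤-antisym (pos-ancestral (1 , refl)) (least p))

    parent-mem : ∀ {x y} → P y → P x → Desc par y x → y ≢ x → P (par y)
    parent-mem {x} {y} py px y≤x y≢x with P? (par y)
    ... | yes p = p
    ... | no ¬p = ⊥-elim (y≢x (desc-antisym y≤x x≤y))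
      where
      x≤y : Desc par x y
      x≤y = stays-below (⊥-elim ∘ ¬p) (0 , refl) (connected y x py px)

    between-mem : ∀ {x y a} → P y → P x → Desc par y a → Desc par a x → P a
    between-mem {x} {a = a} py px (k , eq) a≤x = go k py eq
      where
      go : ∀ {y} k → P y → iter par k y ≡ a → P a
      go zero py refl = py
      go {y} (suc k) py eq with y ≟ x
      ... | yes refl = subst P (desc-antisym (suc k , eq) a≤x) py
      ... | no  y≢x  = go k (parent-mem py px (desc-trans par (suc k , eq) a≤x) y≢x)
                            (trans (sym (iter-suc par k y)) eq)

    top-below : ∀ {t e x} → P t → (∀ {y} → P y → Desc par y t) →
                P e → Desc par e x → (P x → x ≡ t) → Desc par t x
    top-below pt top pe e≤x x-top with ancestors-comparable par (top pe) e≤x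
    ... | inj₁ t≤x = t≤x
    ... | inj₂ x≤t = 0 , sym (x-top (between-mem pe pt e≤x x≤t))

module Reparenting {n m} (E : Hypergraph n m) (ord : Fin m ↔ Fin m) where
  open Inverse ord using (to; from; strictlyInverseˡ; strictlyInverseʳ)

  ∈-to∘from : ∀ {v x} → v ∈ E x → v ∈ E (to (from x))
  ∈-to∘from {v} {x} = subst (λ y → v ∈ E y) (sym (strictlyInverseˡ x))

  lam-sound : ∀ {v l} → lam E ord v ≡ just l → v ∈ E (to l)
  lam-sound {v} = minIndex-sound (λ i → v ∈? E (to i))

  lam-least : ∀ {v l x} → lam E ord v ≡ just l → v ∈ E x → l ≤ from x
  lam-least {v} eq v∈x = minIndex-least (λ i → v ∈? E (to i)) eq (∈-to∘from v∈x)

  lam-complete : ∀ {v x} → v ∈ E x → ∃ λ l → lam E ord v ≡ just l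
  lam-complete {v} v∈x = minIndex-complete (λ i → v ∈? E (to i)) (∈-to∘from v∈x)

  upλ-sound : ∀ i v {l} → upλ E ord i v ≡ just l →
              v ∈ E (to i) × lam E ord v ≡ just l × l < i
  upλ-sound i v eq with v ∈? E (to i) | lam E ord v
  ... | yes v∈ | just l with l <? i
  ...   | yes l<i rewrite dec-true  (l <? i) l<i with refl ← eq = v∈ , refl , l<i
  ...   | no  l≮i rewrite dec-false (l <? i) l≮i with () ← eq
  upλ-sound i v () | yes _ | nothing
  upλ-sound i v () | no _  | _

  upλ-complete : ∀ i v {l} → v ∈ E (to i) → lam E ord v ≡ just l → l < i →
                 upλ E ord i v ≡ just l
  upλ-complete i v {l} v∈ lv l<i with v ∈? E (to i)
  ... | no v∉ = ⊥-elim (v∉ v∈)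
  ... | yes _ rewrite lv | dec-true (l <? i) l<i = refl

  parentIndex-attained : ∀ i {j} → parentIndex E ord i ≡ just j →
                         ∃ λ u → upλ E ord i u ≡ just j
  parentIndex-attained i = maxOf-attained (upλ E ord i) (allFin n)

  parentIndex-upper : ∀ i u {l} → upλ E ord i u ≡ just l →
                      ∃ λ j → parentIndex E ord i ≡ just j × l ≤ j
  parentIndex-upper i u = maxOf-upper (upλ E ord i) (∈-allFin u)

  parentIndex-< : ∀ x {j} → parentIndex E ord (from x) ≡ just j → from (to j) < from x
  parentIndex-< x {j} eq with u , up≡j ← parentIndex-attained (from x) eq
    rewrite strictlyInverseʳ j =
    proj₂ (proj₂ (upλ-sound (from x) u up≡j))

  newParent-just : ∀ x {j} → parentIndex E ord (from x) ≡ just j →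
                   newParent E ord x ≡ to j
  newParent-just x eq rewrite eq = refl

module NewJoinTree {n m} (E : Hypergraph n m) (connected : IncidenceConnected E)
  (par : Fin m → Fin m) (R : Fin m) (joinTree : IsJoinTree E par R) (ord : Fin m ↔ Fin m)
  (ancestral : ∀ x y → Desc par y x → Inverse.from ord x ≤ Inverse.from ord y) where

  open Inverse ord using (to; from; strictlyInverseˡ; strictlyInverseʳ)
  open Reparenting E ord
  open AncestralOrder par from (Injection.injective (↔⇒↣ (↔-sym ord))) (ancestral _ _)
  module Edges v = ConnectedSubtree (λ x → v ∈ E x) (λ x → v ∈? E x) (proj₂ joinTree v)

  T′ : Fin m → Fin m
  T′ = newParent E ord

  root-reachable : ∀ x → Desc par x R
  root-reachable = proj₂ (proj₁ joinTree)

  lam-top : ∀ {v l y} → lam E ord v ≡ just l → v ∈ E y → Desc par y (to l)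
  lam-top {l = l} lv = Edges.least-is-top _ (lam-sound lv) λ v∈x →
    subst (_≤ from _) (sym (strictlyInverseʳ l)) (lam-least lv v∈x)

  lam-≤⇒∈ : ∀ {u v j l x} → lam E ord v ≡ just l → lam E ord u ≡ just j →
            v ∈ E x → u ∈ E x → l ≤ j → v ∈ E (to j)
  lam-≤⇒∈ {v = v} {j} {l} lv lu v∈x u∈x l≤j
    with ancestors-comparable par (lam-top lu u∈x) (lam-top lv v∈x)
  ... | inj₁ top-u≤top-v =
    Edges.between-mem v v∈x (lam-sound lv) (lam-top lu u∈x) top-u≤top-v
  ... | inj₂ top-v≤top-u =
    subst (λ k → v ∈ E (to k)) (Fin.≤-antisym l≤j j≤l) (lam-sound lv)
    where
    j≤l : j ≤ l
    j≤l = subst₂ _≤_ (strictlyInverseʳ j) (strictlyInverseʳ l) (ancestral _ _ top-v≤top-u)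

  upλ-below-top : ∀ {v l x} → lam E ord v ≡ just l → v ∈ E x → x ≢ to l →
                  upλ E ord (from x) v ≡ just l
  upλ-below-top {v} {l} {x} lv v∈x x≢top =
    upλ-complete (from x) v (∈-to∘from v∈x) lv
      (Fin.≤∧≢⇒< (lam-least lv v∈x) l≢x)
    where
    l≢x : l ≢ from x
    l≢x l≡x = x≢top (trans (sym (strictlyInverseˡ x)) (cong to (sym l≡x)))

  T′-decreasing : ∀ {x j} → parentIndex E ord (from x) ≡ just j → from (T′ x) < from x
  T′-decreasing {x} pi≡j =
    subst (λ y → from y < from x) (sym (newParent-just x pi≡j))
      (parentIndex-< x pi≡j)

  T′-keeps : ∀ {v l x} → lam E ord v ≡ just l → v ∈ E x → x ≢ to l →
             v ∈ E (T′ x) × from (T′ x) < from x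
  T′-keeps {v} {l} {x} lv v∈x x≢top
    with j , pi≡j , l≤j ← parentIndex-upper (from x) v (upλ-below-top lv v∈x x≢top)
    with u , up≡j ← parentIndex-attained (from x) pi≡j
    with u∈x , lu , _ ← upλ-sound (from x) u up≡j
    = subst (λ y → v ∈ E y) (sym (newParent-just x pi≡j))
        (lam-≤⇒∈ lv lu (∈-to∘from v∈x) u∈x l≤j)
    , T′-decreasing pi≡j

  S↑-empty⇒top : ∀ {x u l} → parentIndex E ord (from x) ≡ nothing →
                 u ∈ E x → lam E ord u ≡ just l → x ≡ to l
  S↑-empty⇒top {x} {u} {l} pi≡nothing u∈x lu with x ≟ to l
  ... | yes x≡top = x≡top
  ... | no  x≢top
    with j , pi≡j , _ ← parentIndex-upper (from x) u (upλ-below-top lu u∈x x≢top)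
    with () ← trans (sym pi≡nothing) pi≡j

  Below : Fin m → Fin n ⊎ Fin m → Set
  Below x (inj₁ u) = ∀ {e} → u ∈ E e → Desc par e x
  Below x (inj₂ e) = Desc par e x

  below-step : ∀ {x a b} → parentIndex E ord (from x) ≡ nothing →
               IncAdj E a b → Below x a → Below x b
  below-step {a = inj₁ _} {inj₁ _} _ ()
  below-step {a = inj₂ _} {inj₂ _} _ ()
  below-step {a = inj₁ u} {inj₂ e} _ u∈e below-u = below-u u∈e
  below-step {a = inj₂ e} {inj₁ u} pi≡nothing u∈e e≤x {e′} u∈e′
    with l , lu ← lam-complete u∈e =
      desc-trans par (lam-top lu u∈e′)
        (Edges.top-below u (lam-sound lu) (lam-top lu) u∈e e≤x
          (λ u∈x → S↑-empty⇒top pi≡nothing u∈x lu))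

  S↑-empty⇒root : ∀ {x} → parentIndex E ord (from x) ≡ nothing → x ≡ R
  S↑-empty⇒root {x} pi≡nothing = desc-antisym (root-reachable x) (below-R (0 , refl))
    where
    below-R : Below x (inj₂ x) → Below x (inj₂ R)
    below-R = Star.fold (λ a b → Below x a → Below x b)
                (λ step rest → rest ∘ below-step pi≡nothing step) id
                (connected (inj₂ x) (inj₂ R))

  T′-descends : ∀ {x} → x ≢ R → from (T′ x) < from x
  T′-descends {x} x≢R with parentIndex E ord (from x) in pi≡
  ... | nothing = ⊥-elim (x≢R (S↑-empty⇒root pi≡))
  ... | just _  = parentIndex-< x pi≡

  T′-root : T′ R ≡ R
  T′-root with parentIndex E ord (from R) in pi≡
  ... | nothing = refl
  ... | just _  =
    ⊥-elim (ℕ.<⇒≱ (parentIndex-< R pi≡) (ancestral _ _ (root-reachable _)))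

  T′-rooted : ∀ x → Desc T′ x R
  T′-rooted x = upPath⇒desc (climb T′ (λ _ → ⊤) (toℕ ∘ from) R descends _)
    where
    descends : ∀ {x} → ⊤ → x ≢ R → ⊤ × from (T′ x) < from x
    descends _ x≢R = _ , T′-descends x≢R

  T′-subtreeConnected : ∀ v → SubtreeConnected E T′ v
  T′-subtreeConnected v x y v∈x v∈y with l , lv ← lam-complete v∈x =
    Star.map upStep⇒adj (to-top v∈x) ◅◅ Star.reverse upStep⇒adj⁻¹ (to-top v∈y)
    where
    to-top : ∀ {z} → v ∈ E z → Star (UpStep T′ (λ z → v ∈ E z)) z (to l)
    to-top = climb T′ (λ z → v ∈ E z) (toℕ ∘ from) (to l) (T′-keeps lv)

  newJoinTree : IsJoinTree E T′ R
  newJoinTree = (T′-root , T′-rooted) , T′-subtreeConnected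

lemma5 : (n m : ℕ) (E : Hypergraph n m) →
         NonemptyEdges E → IncidenceConnected E →
         (par : Fin m → Fin m) (R : Fin m) → IsJoinTree E par R →
         (ord : Fin m ↔ Fin m) → IsPreorder par ord →
         IsJoinTree E (newParent E ord) R
lemma5 n m E _ connected par R joinTree ord preorder =
  NewJoinTree.newJoinTree E connected par R joinTree ord (proj₁ preorder)
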